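{- Every countable ordinal is the $\mathrm S$ of a nondecreasing sequence of countable ordinals: for every $\alpha\in\mathrm{ord}_2$ there exist $I\in\mathfrak F_2$ and a family $(\beta_n)_{n\in I}$ in $\mathrm{ord}_2$ with $\beta_n\le\beta_{n'}$ whenever $n\le n'$ in $I$, such that $\alpha=_{\mathrm{Ord}}\mathrm S(\beta_n)_{n\in I}$.
   Context: The setting is constructive. $\mathfrak F_2=\{\mathbb N_k:k\in\mathbb N\}\cup\{\mathbb N\}$ with $\mathbb N_k=\{n\in\mathbb N:n<k\}$ (with the natural operations for finite subsets and disjoint unions). The set $\mathrm{ord}_2$ is defined inductively: a distinguished element $\underline 0$, and for every $I\in\mathfrak F_2$ and family $(\alpha_i)_{i\in I}$ in $\mathrm{ord}_2$ an element $\mathrm S(\alpha_i)_{i\in I}$. For $\alpha=\mathrm S(\alpha_i)_{i\in I}$, $\mathrm{In}_\alpha=I$; by convention $\mathrm{In}_{\underline0}=\mathbb N_0=\emptyset$ (so $\underline0$ plays the role of $\mathrm S$ of the empty family). For a finite list $F\subseteq_f\mathrm{In}_\alpha$, $\alpha_F$ is the list of the $\alpha_i$, $i\in F$. By simultaneous induction ($m\ge1$): $\alpha\le\beta^1,\dots,\beta^m$ means $\alpha_i<\beta^1,\dots,\beta^m$ for all $i\in\mathrm{In}_\alpha$; $\alpha<\beta^1,\dots,\beta^m$ means there exist $F_k\subseteq_f\mathrm{In}_{\beta^k}$, not all empty, with $\alpha\le\beta^1_{F_1},\dots,\beta^m_{F_m}$; $m=1$ gives binary $\le,<$. $\alpha=_{\mathrm{Ord}}\beta$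 means $\alpha\le\beta$ and $\beta\le\alpha$. -}

module Defs where

open import Data.Nat using (ℕ; zero; suc; _≤_)
open import Data.Fin using (Fin; toℕ)
open import Data.List using (List; []; _∷_; map; _++_)
open import Data.Product using (Σ; _×_; _,_)
open import Data.Sum using (_⊎_)
open import Data.Unit using (⊤)
open import Data.Empty using (⊥)

-- 𝔉₂ : index sets ℕ_k (k ∈ ℕ) and ℕ, given by codes
data F2 : Set where
  finN : ℕ → F2
  natN : F2

El : F2 → Set
El (finN k) = Fin k
El natN     = ℕ

-- the underlying natural number of an index (order on I is the order of ℕ)
idx : {I : F2} → El I → ℕ
idx {finN k} i = toℕ i
idx {natN}   n = n

data Ord₂ : Set where
  𝟘 : Ord₂
  S : (I : F2) → (El I → Ord₂) → Ord₂

In : Ord₂ → F2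
In 𝟘       = finN 0
In (S I _) = I

comp : (α : Ord₂) → El (In α) → Ord₂
comp 𝟘       ()
comp (S _ f) i = f i

-- a choice of finite lists F_k ⊆_f In_{β^k}, one for each β^k in the list β¹,…,βᵐ
Choice : List Ord₂ → Set
Choice []      = ⊤
Choice (β ∷ L) = List (El (In β)) × Choice L

flatten : (L : List Ord₂) → Choice L → List Ord₂
flatten []      _        = []
flatten (β ∷ L) (F , Fs) = map (comp β) F ++ flatten L Fs

NonEmptyList : {A : Set} → List A → Set
NonEmptyList []      = ⊥
NonEmptyList (_ ∷ _) = ⊤

NotAllEmpty : (L : List Ord₂) → Choice L → Set
NotAllEmpty []      _        = ⊥
NotAllEmpty (β ∷ L) (F , Fs) = NonEmptyList F ⊎ NotAllEmpty L Fs

mutual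
  _≤*_ : Ord₂ → List Ord₂ → Set
  𝟘       ≤* L = ⊤   -- In_𝟘 = ∅, so the condition is vacuous
  (S I f) ≤* L = (i : El I) → f i <* L

  _<*_ : Ord₂ → List Ord₂ → Set
  α <* L = Σ (Choice L) λ Fs → NotAllEmpty L Fs × (α ≤* flatten L Fs)

_≤O_ : Ord₂ → Ord₂ → Set
α ≤O β = α ≤* (β ∷ [])

_<O_ : Ord₂ → Ord₂ → Set
α <O β = α <* (β ∷ [])

_=Ord_ : Ord₂ → Ord₂ → Set
α =Ord β = (α ≤O β) × (β ≤O α)

{-# OPTIONS --safe #-}
module Submission where

open import Defs
open import Data.Nat using (ℕ; zero; suc; _≤_; _+_; s≤s; s≤s⁻¹; _≤?_)
open import Data.Nat.Properties using (≤-refl; ≤-trans)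
open import Data.Product using (Σ; ∃-syntax; _×_; _,_; proj₂)
open import Data.Sum using (_⊎_; inj₁; inj₂; [_,_]′)
import Data.Sum as Sum
open import Data.Sum.Properties using (swap-involutive)
open import Data.Fin using (Fin; toℕ; splitAt; join) renaming (zero to fzero; suc to fsuc)
open import Data.Fin.Properties using (splitAt-join)
open import Data.List using (List; []; _∷_; map; foldr; filter; allFin; upTo)
open import Data.List.Properties using (++-identityʳ)
open import Data.List.Relation.Unary.Any using (here; there)
open import Data.List.Membership.Propositional using (_∈_)
open import Data.List.Membership.Propositional.Properties
  using (∈-map⁺; ∈-allFin; ∈-filter⁺; ∈-filter⁻; ∈-upTo⁺; ∈-upTo⁻)
open import Data.List.Relation.Binary.Subset.Propositional using (_⊆_)
import Data.List.Relation.Binary.Subset.Propositional.Properties as ⊆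
open import Data.Unit using (tt)
open import Function using (_∘_)
open import Relation.Binary.PropositionalEquality using (_≡_; refl; sym; trans; cong; subst)

-- For α = S(αᵢ), take βₙ to be the join of α₀, …, αₙ: the S of the disjoint union of
-- their families of components.  Components of βₙ are exactly those of the αⱼ with
-- j ≤ n, so βₙ grows with n, αᵢ ≤ βᵢ, and βₙ < α₀, …, αₙ, i.e. βₙ < α with Fₙ = {0, …, n}.

≤O-refl : (α : Ord₂) → α ≤O α
≤O-refl 𝟘       = tt
≤O-refl (S I f) = λ i → (i ∷ [] , tt) , inj₁ tt , ≤O-refl (f i)

infix 4 _∈ᶜ_

record _∈ᶜ_ (γ α : Ord₂) : Set where
  constructor component
  field
    index : El (In α)
    comp≡ : comp α index ≡ γ

≤*-intro : {α : Ord₂} {L : List Ord₂} → (∀ {γ} → γ ∈ᶜ α → γ <* L) → α ≤* L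
≤*-intro {𝟘}     h = tt
≤*-intro {S I f} h = λ i → h (component i refl)

emptyChoice : (L : List Ord₂) → Choice L
emptyChoice []      = tt
emptyChoice (β ∷ L) = [] , emptyChoice L

flatten-emptyChoice : (L : List Ord₂) → flatten L (emptyChoice L) ≡ []
flatten-emptyChoice []      = refl
flatten-emptyChoice (β ∷ L) = flatten-emptyChoice L

singletonChoice : {β : Ord₂} {L : List Ord₂} → β ∈ L → (k : El (In β)) →
  Σ (Choice L) λ Fs → NotAllEmpty L Fs × (flatten L Fs ≡ comp β k ∷ [])
singletonChoice {β} {.β ∷ L} (here refl) k =
  (k ∷ [] , emptyChoice L) , inj₁ tt , cong (comp β k ∷_) (flatten-emptyChoice L)
singletonChoice (there β∈L) k with singletonChoice β∈L k
... | Fs , ne , eq = ([] , Fs) , inj₂ ne , eq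

∈ᶜ⇒<* : {γ β : Ord₂} {L : List Ord₂} → β ∈ L → γ ∈ᶜ β → γ <* L
∈ᶜ⇒<* {γ} β∈L (component k refl) with singletonChoice β∈L k
... | Fs , ne , eq = Fs , ne , subst (γ ≤*_) (sym eq) (≤O-refl γ)

∈ᶜ⇒<O : {γ β : Ord₂} → γ ∈ᶜ β → γ <O β
∈ᶜ⇒<O = ∈ᶜ⇒<* (here refl)

∈⇒NonEmptyList : {A : Set} {x : A} {xs : List A} → x ∈ xs → NonEmptyList xs
∈⇒NonEmptyList (here _)  = tt
∈⇒NonEmptyList (there _) = tt

<O-intro : {α β : Ord₂} (F : List (El (In β))) → NonEmptyList F →
  α ≤* map (comp β) F → α <O β
<O-intro {α} {β} F ne α≤ =
  (F , tt) , inj₁ ne , subst (α ≤*_) (sym (++-identityʳ (map (comp β) F))) α≤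

_⊕_ : F2 → F2 → F2
finN a ⊕ finN b = finN (a + b)
finN a ⊕ natN   = natN
natN   ⊕ finN b = natN
natN   ⊕ natN   = natN

splitAtℕ : (a : ℕ) → ℕ → Fin a ⊎ ℕ
splitAtℕ zero    n       = inj₂ n
splitAtℕ (suc a) zero    = inj₁ fzero
splitAtℕ (suc a) (suc n) = Sum.map₁ fsuc (splitAtℕ a n)

splitAtℕ-surjective : (a : ℕ) (x : Fin a ⊎ ℕ) → ∃[ n ] splitAtℕ a n ≡ x
splitAtℕ-surjective zero    (inj₂ m)        = m , refl
splitAtℕ-surjective (suc a) (inj₁ fzero)    = zero , refl
splitAtℕ-surjective (suc a) (inj₁ (fsuc i)) with splitAtℕ-surjective a (inj₁ i)
... | n , eq = suc n , cong (Sum.map₁ fsuc) eq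
splitAtℕ-surjective (suc a) (inj₂ m)        with splitAtℕ-surjective a (inj₂ m)
... | n , eq = suc n , cong (Sum.map₁ fsuc) eq

splitParity : ℕ → ℕ ⊎ ℕ
splitParity zero          = inj₁ zero
splitParity (suc zero)    = inj₂ zero
splitParity (suc (suc n)) = Sum.map suc suc (splitParity n)

splitParity-surjective : (x : ℕ ⊎ ℕ) → ∃[ n ] splitParity n ≡ x
splitParity-surjective (inj₁ zero)    = zero , refl
splitParity-surjective (inj₂ zero)    = suc zero , refl
splitParity-surjective (inj₁ (suc m)) with splitParity-surjective (inj₁ m)
... | n , eq = suc (suc n) , cong (Sum.map suc suc) eq
splitParity-surjective (inj₂ (suc m)) with splitParity-surjective (inj₂ m)
... | n , eq = suc (suc n) , cong (Sum.map suc suc) eq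

-- Only surjectivity of split matters: repeated components do not change an ordinal up to =Ord.
split : (I J : F2) → El (I ⊕ J) → El I ⊎ El J
split (finN a) (finN b) = splitAt a
split (finN a) natN     = splitAtℕ a
split natN     (finN b) = Sum.swap ∘ splitAtℕ b
split natN     natN     = splitParity

split-surjective : (I J : F2) (x : El I ⊎ El J) → ∃[ k ] split I J k ≡ x
split-surjective (finN a) (finN b) x = join a b x , splitAt-join a b x
split-surjective (finN a) natN     x = splitAtℕ-surjective a x
split-surjective natN     (finN b) x with splitAtℕ-surjective b (Sum.swap x)
... | n , eq = n , trans (cong Sum.swap eq) (swap-involutive x)
split-surjective natN     natN     x = splitParity-surjective x

infixr 6 _⊔_

_⊔_ : Ord₂ → Ord₂ → Ord₂
α ⊔ β = S (In α ⊕ In β) ([ comp α , comp β ]′ ∘ split (In α) (In β))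

∈ᶜ-⊔⁺ˡ : {γ α β : Ord₂} → γ ∈ᶜ α → γ ∈ᶜ α ⊔ β
∈ᶜ-⊔⁺ˡ {α = α} {β} (component k eq) with split-surjective (In α) (In β) (inj₁ k)
... | k′ , split≡ = component k′ (trans (cong [ comp α , comp β ]′ split≡) eq)

∈ᶜ-⊔⁺ʳ : {γ α β : Ord₂} → γ ∈ᶜ β → γ ∈ᶜ α ⊔ β
∈ᶜ-⊔⁺ʳ {α = α} {β} (component k eq) with split-surjective (In α) (In β) (inj₂ k)
... | k′ , split≡ = component k′ (trans (cong [ comp α , comp β ]′ split≡) eq)

∈ᶜ-⊔⁻ : {γ α β : Ord₂} → γ ∈ᶜ α ⊔ β → γ ∈ᶜ α ⊎ γ ∈ᶜ β
∈ᶜ-⊔⁻ {α = α} {β} (component k′ eq) with split (In α) (In β) k′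
... | inj₁ k = inj₁ (component k eq)
... | inj₂ k = inj₂ (component k eq)

⋁ : List Ord₂ → Ord₂
⋁ = foldr _⊔_ 𝟘

∈ᶜ-⋁⁺ : {γ α : Ord₂} {L : List Ord₂} → α ∈ L → γ ∈ᶜ α → γ ∈ᶜ ⋁ L
∈ᶜ-⋁⁺ {L = α ∷ L} (here refl)  γ∈α = ∈ᶜ-⊔⁺ˡ {β = ⋁ L} γ∈α
∈ᶜ-⋁⁺ {L = β ∷ L} (there α∈L) γ∈α = ∈ᶜ-⊔⁺ʳ {α = β} (∈ᶜ-⋁⁺ α∈L γ∈α)

∈ᶜ-⋁⁻ : {γ : Ord₂} (L : List Ord₂) → γ ∈ᶜ ⋁ L → ∃[ α ] α ∈ L × γ ∈ᶜ α
∈ᶜ-⋁⁻ []      (component () _)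
∈ᶜ-⋁⁻ (α ∷ L) γ∈⊔ with ∈ᶜ-⊔⁻ {α = α} γ∈⊔
... | inj₁ γ∈α = α , here refl , γ∈α
... | inj₂ γ∈⋁ with ∈ᶜ-⋁⁻ L γ∈⋁
...   | β , β∈L , γ∈β = β , there β∈L , γ∈β

≤O-⋁ : {α : Ord₂} {L : List Ord₂} → α ∈ L → α ≤O ⋁ L
≤O-⋁ α∈L = ≤*-intro (∈ᶜ⇒<O ∘ ∈ᶜ-⋁⁺ α∈L)

⋁-mono : {L L′ : List Ord₂} → L ⊆ L′ → ⋁ L ≤O ⋁ L′
⋁-mono {L} L⊆L′ = ≤*-intro λ γ∈⋁ →
  let α , α∈L , γ∈α = ∈ᶜ-⋁⁻ L γ∈⋁ in ∈ᶜ⇒<O (∈ᶜ-⋁⁺ (L⊆L′ α∈L) γ∈α)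

⋁-≤* : (L : List Ord₂) → ⋁ L ≤* L
⋁-≤* L = ≤*-intro λ γ∈⋁ → let α , α∈L , γ∈α = ∈ᶜ-⋁⁻ L γ∈⋁ in ∈ᶜ⇒<* α∈L γ∈α

initialSegment : {I : F2} → El I → List (El I)
initialSegment {finN a} i = filter (λ j → toℕ j ≤? toℕ i) (allFin a)
initialSegment {natN}   n = upTo (suc n)

∈-initialSegment⁺ : {I : F2} {i j : El I} → idx j ≤ idx i → j ∈ initialSegment i
∈-initialSegment⁺ {finN a} {i} {j} j≤i = ∈-filter⁺ (λ j → toℕ j ≤? toℕ i) (∈-allFin j) j≤i
∈-initialSegment⁺ {natN}           j≤i = ∈-upTo⁺ (s≤s j≤i)

∈-initialSegment⁻ : {I : F2} {i j : El I} → j ∈ initialSegment i → idx j ≤ idx i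
∈-initialSegment⁻ {finN a} {i} j∈ = proj₂ (∈-filter⁻ (λ j → toℕ j ≤? toℕ i) {xs = allFin a} j∈)
∈-initialSegment⁻ {natN}       j∈ = s≤s⁻¹ (∈-upTo⁻ j∈)

initialSegment-mono : {I : F2} {i i′ : El I} → idx i ≤ idx i′ →
  initialSegment i ⊆ initialSegment i′
initialSegment-mono i≤i′ j∈ = ∈-initialSegment⁺ (≤-trans (∈-initialSegment⁻ j∈) i≤i′)

lemma5p1 : (α : Ord₂) →
    Σ F2 λ I → Σ (El I → Ord₂) λ β →
      ((n n′ : El I) → idx n ≤ idx n′ → β n ≤O β n′) × (α =Ord S I β)
lemma5p1 𝟘       = finN 0 , (λ ()) , (λ ()) , tt , (λ ())
lemma5p1 (S I f) = I , β , β-mono , S≤Sβ , Sβ≤S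
  where
  prefix : El I → List Ord₂
  prefix n = map f (initialSegment n)

  β : El I → Ord₂
  β n = ⋁ (prefix n)

  β-mono : (n n′ : El I) → idx n ≤ idx n′ → β n ≤O β n′
  β-mono n n′ n≤n′ = ⋁-mono (⊆.map⁺ f (initialSegment-mono n≤n′))

  f∈prefix : (i : El I) → f i ∈ prefix i
  f∈prefix i = ∈-map⁺ f (∈-initialSegment⁺ ≤-refl)

  S≤Sβ : S I f ≤O S I β
  S≤Sβ i = <O-intro (i ∷ []) tt (≤O-⋁ (f∈prefix i))

  Sβ≤S : S I β ≤O S I f
  Sβ≤S n = <O-intro (initialSegment n) (∈⇒NonEmptyList (∈-initialSegment⁺ ≤-refl)) (⋁-≤* (prefix n))
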